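{- Let $n\ge r\ge 5$ and let $G$ be a graph on $n$ vertices with an edge-coloring making it $C_r$-rainbow saturated. If $G$ has at least one good root, then $e(G)\ge \frac{6}{5}n$.
   Context: All graphs are finite, simple and undirected. An edge-coloring is a function $E(G)\to\mathbb{N}$; a (sub)graph is rainbow if its edges have distinct colors. An edge-colored graph is $C_r$-rainbow saturated if it contains no rainbow cycle on $r$ vertices but adding any nonedge with any color creates a rainbow cycle on $r$ vertices. A good root of $G$ is a vertex $u$ of degree 2 whose two neighbours both have degree at least 3. -}

module Defs where

open import Data.Nat using (ℕ; zero; suc; _<_; _≤_; _≟_; _<?_)
open import Data.Nat.ListAction using (sum)
open import Data.Empty using (⊥)
open import Relation.Nullary using (yes; no)
open import Data.Fin as Fin using (Fin; toℕ; lower₁)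
open import Data.Bool using (Bool; true; false; _∧_; _∨_; if_then_else_)
open import Data.List using (List; length; filterᵇ; map)
open import Data.List using () renaming (allFin to allFinL)
open import Data.Product using (Σ; _×_; _,_)
open import Function.Definitions using (Injective)
open import Relation.Binary.PropositionalEquality using (_≡_; _≢_)
open import Relation.Nullary.Decidable using (⌊_⌋)

record Graph (n : ℕ) : Set where
  field
    adj     : Fin n → Fin n → Bool
    sym     : ∀ i j → adj i j ≡ adj j i
    irrefl  : ∀ i → adj i i ≡ false
open Graph public

countF : ∀ {n} → (Fin n → Bool) → ℕ
countF {n} p = length (filterᵇ p (allFinL n))

degree : ∀ {n} → Graph n → Fin n → ℕ
degree G u = countF (adj G u)

edgeCount : ∀ {n} → Graph n → ℕ
edgeCount {n} G = sum (map (λ i → countF (λ j → ⌊ toℕ i <? toℕ j ⌋ ∧ adj G i j)) (allFinL n))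

-- An edge-coloring is represented by a symmetric function c : Fin n → Fin n → ℕ;
-- only its values on edges matter.
SymColoring : ℕ → Set
SymColoring n = Σ (Fin n → Fin n → ℕ) (λ c → ∀ i j → c i j ≡ c j i)

next : ∀ {m} → Fin (suc m) → Fin (suc m)
next {m} i with m ≟ toℕ i
... | yes _ = Fin.zero
... | no ne = Fin.suc (lower₁ i ne)

HasRainbowCycle : ∀ {n} → (Fin n → Fin n → Bool) → (Fin n → Fin n → ℕ) → ℕ → Set
HasRainbowCycle adj' col zero = ⊥
HasRainbowCycle {n} adj' col (suc m) =
  Σ (Fin (suc m) → Fin n) λ v →
    Injective _≡_ _≡_ v
    × (∀ k → adj' (v k) (v (next k)) ≡ true)
    × Injective _≡_ _≡_ (λ k → col (v k) (v (next k)))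

isPair : ∀ {n} → Fin n → Fin n → Fin n → Fin n → Bool
isPair x y i j = (⌊ i Fin.≟ x ⌋ ∧ ⌊ j Fin.≟ y ⌋) ∨ (⌊ i Fin.≟ y ⌋ ∧ ⌊ j Fin.≟ x ⌋)

addAdj : ∀ {n} → Graph n → Fin n → Fin n → Fin n → Fin n → Bool
addAdj G x y i j = adj G i j ∨ isPair x y i j

addCol : ∀ {n} → (Fin n → Fin n → ℕ) → Fin n → Fin n → ℕ → Fin n → Fin n → ℕ
addCol c x y a i j = if isPair x y i j then a else c i j

RainbowSaturated : ∀ {n} → Graph n → SymColoring n → ℕ → Set
RainbowSaturated {n} G (c , _) r =
  (HasRainbowCycle (adj G) c r → ⊥)
  × (∀ (x y : Fin n) → x ≢ y → adj G x y ≡ false → ∀ (a : ℕ) →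
       HasRainbowCycle (addAdj G x y) (addCol c x y a) r)

GoodRoot : ∀ {n} → Graph n → Fin n → Set
GoodRoot G u = degree G u ≡ 2 × (∀ w → adj G u w ≡ true → 3 ≤ degree G w)

-- Saturation is used through one consequence: if xy is a non-edge and a is any colour, the
-- rainbow C_r that appears when xy is added with colour a continues from x, y along a path
-- y z₁ z₂ z₃ of G avoiding x and y (here r ≥ 5 is needed), with c(y z₁) ≠ a.  Choosing x and a
-- suitably shows that every vertex has degree at least 2, that two adjacent vertices of degree 2
-- span a triangle with a third vertex b, and that such a b has degree at least 4.
-- Discharging: vertex v starts with charge 5 d(v) − 12; every vertex of degree ≠ 2 sends 1 to each
-- neighbour of degree 2, or 2 if that neighbour itself has a neighbour of degree 2.  Afterwards no
-- charge is negative, so the total 10 e(G) − 12 n is non-negative.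
module Submission where

open import Defs renaming (sym to adj-sym; irrefl to adj-irrefl)
open import Data.Nat as ℕ using (ℕ; zero; suc; _+_; _*_; _∸_; _≤_; _<_; _<?_; z≤n; s≤s; z<s)
open import Data.Nat.Properties hiding (_≟_)
open import Algebra.Properties.Semiring.Sum +-*-semiring
  using (sum; sum-syntax; ∑-distrib-+; ∑-comm; sum-cong-≗; *-distribˡ-sum)
import Data.Nat.ListAction as List
open import Data.Bool as Bool using (Bool; true; false; _∧_; _∨_; not; if_then_else_)
open import Data.Bool.Properties using (¬-not; ∧-identityʳ; ∨-identityʳ; ∧-comm; ∨-comm)
open import Data.Empty using (⊥; ⊥-elim)
open import Data.Sum using (_⊎_; inj₁; inj₂)
open import Data.Product using (Σ; ∃; _×_; _,_; proj₁; proj₂)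
open import Data.Fin using (Fin; zero; suc; _≟_; toℕ; lower₁; opposite)
open import Data.Fin.Patterns using (0F; 1F; 2F; 3F; 4F)
open import Data.Fin.Properties
  using (any?; all?; ¬∀⟶∃¬; injective⇒≤; toℕ-injective; toℕ-lower₁; toℕ<n; opposite-prop; opposite-involutive)
open import Data.List using (List; []; _∷_; length; map; lookup; filterᵇ; tabulate)
open import Data.List.Membership.Propositional using (_∈_; _∉_)
open import Data.List.Membership.Propositional.Properties using (∈-++⁺ˡ)
open import Data.List.Relation.Unary.All as All using (All; []; _∷_)
open import Data.List.Relation.Unary.Any using (here; there; index)
open import Data.List.Relation.Unary.Any.Properties using (lookup-index)
open import Data.List.Relation.Unary.Unique.Propositional using (Unique; []; _∷_)
open import Function using (_∘_; id; case_of_)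
open import Relation.Nullary using (¬_; Dec; yes; no; does; contradiction; _×-dec_)
open import Relation.Nullary.Decidable using (⌊_⌋; dec-false)
open import Relation.Binary.PropositionalEquality

sum-const : ∀ n k → ∑[ i < n ] k ≡ n * k
sum-const zero    k = refl
sum-const (suc n) k = cong (k +_) (sum-const n k)

sum-mono-≤ : ∀ {n} {f g : Fin n → ℕ} → (∀ i → f i ≤ g i) → sum f ≤ sum g
sum-mono-≤ {zero}  f≤g = z≤n
sum-mono-≤ {suc n} f≤g = +-mono-≤ (f≤g zero) (sum-mono-≤ (f≤g ∘ suc))

term≤sum : ∀ {n} (f : Fin n → ℕ) i → f i ≤ sum f
term≤sum f zero    = m≤m+n (f zero) _
term≤sum f (suc i) = ≤-trans (term≤sum (f ∘ suc) i) (m≤n+m _ (f zero))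

sum-tabulate : ∀ {n k} (f : Fin n → ℕ) (g : Fin k → Fin n) →
               List.sum (map f (tabulate g)) ≡ ∑[ i < k ] f (g i)
sum-tabulate {k = zero}  f g = refl
sum-tabulate {k = suc k} f g = cong (f (g zero) +_) (sum-tabulate f (g ∘ suc))

indicator : Bool → ℕ
indicator true  = 1
indicator false = 0

count : ∀ {n} → (Fin n → Bool) → ℕ
count {n} p = ∑[ i < n ] indicator (p i)

length-filter-tabulate : ∀ {n k} (p : Fin n → Bool) (g : Fin k → Fin n) →
                         length (filterᵇ p (tabulate g)) ≡ ∑[ i < k ] indicator (p (g i))
length-filter-tabulate {k = zero}  p g = refl
length-filter-tabulate {k = suc k} p g with p (g zero)
... | true  = cong suc (length-filter-tabulate p (g ∘ suc))
... | false = length-filter-tabulate p (g ∘ suc)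

countF≡count : ∀ {n} (p : Fin n → Bool) → countF p ≡ count p
countF≡count p = length-filter-tabulate p id

module _ {n : ℕ} where
  open import Data.List.Membership.DecPropositional (_≟_ {n}) using (_∈?_)

  ∃∉ : (xs : List (Fin n)) → length xs < n → ∃ (_∉ xs)
  ∃∉ xs |xs|<n with all? (_∈? xs)
  ... | no ¬all∈ = ¬∀⟶∃¬ n (_∈ xs) (_∈? xs) ¬all∈
  ... | yes all∈ = contradiction (injective⇒≤ index-injective) (<⇒≱ |xs|<n)
    where
    index-injective : ∀ {i j} → index (all∈ i) ≡ index (all∈ j) → i ≡ j
    index-injective {i} {j} eq =
      trans (lookup-index (all∈ i)) (trans (cong (lookup xs) eq) (sym (lookup-index (all∈ j))))

-- does rather than ⌊_⌋ (isYes): only does computes through the map′ in suc x ≟ suc y.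
_∖_ : ∀ {n} → (Fin n → Bool) → Fin n → Fin n → Bool
(p ∖ x) j = p j ∧ not (does (j ≟ x))

∖-true⁻ : ∀ {n} (p : Fin n → Bool) {x j} → (p ∖ x) j ≡ true → p j ≡ true × j ≢ x
∖-true⁻ p {x} {j} eq with p j | j ≟ x
... | true | no j≢x = refl , j≢x

∖-true⁺ : ∀ {n} (p : Fin n → Bool) {x j} → p j ≡ true → j ≢ x → (p ∖ x) j ≡ true
∖-true⁺ p {x} {j} pj j≢x rewrite pj | dec-false (j ≟ x) j≢x = refl

count-≟ : ∀ {n} (x : Fin n) → count (λ j → does (j ≟ x)) ≡ 1
count-≟ {suc n} zero    = cong suc (trans (sum-const n 0) (*-zeroʳ n))
count-≟ {suc n} (suc x) = count-≟ x

count-remove : ∀ {n} (p : Fin n → Bool) {x} → p x ≡ true → count p ≡ suc (count (p ∖ x))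
count-remove {n} p {x} px = begin
  count p                                       ≡⟨ sum-cong-≗ split ⟩
  ∑[ j < n ] (is-x j + indicator ((p ∖ x) j))  ≡⟨ ∑-distrib-+ is-x (indicator ∘ (p ∖ x)) ⟩
  sum is-x + count (p ∖ x)                      ≡⟨ cong (_+ count (p ∖ x)) (count-≟ x) ⟩
  suc (count (p ∖ x))                           ∎
  where
  open ≡-Reasoning
  is-x : Fin n → ℕ
  is-x j = indicator (does (j ≟ x))
  split : ∀ j → indicator (p j) ≡ is-x j + indicator ((p ∖ x) j)
  split j with j ≟ x
  ... | yes refl rewrite px = refl
  ... | no _     = cong indicator (sym (∧-identityʳ (p j)))

count≡0⇒false : ∀ {n} (p : Fin n → Bool) → count p ≡ 0 → ∀ x → p x ≡ false
count≡0⇒false p count≡0 x = ¬-not λ px →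
  case subst₂ _≤_ (cong indicator px) count≡0 (term≤sum (indicator ∘ p) x) of λ ()

count>0⇒∃ : ∀ {n} (p : Fin n → Bool) → 0 < count p → ∃ λ x → p x ≡ true
count>0⇒∃ {suc n} p count>0 with p zero in p0
... | true  = zero , p0
... | false with x , px ← count>0⇒∃ (p ∘ suc) count>0 = suc x , px

count≡1⇒unique : ∀ {n} (p : Fin n → Bool) → count p ≡ 1 →
                 ∃ λ t → p t ≡ true × ∀ z → p z ≡ true → z ≡ t
count≡1⇒unique p count≡1 with t , pt ← count>0⇒∃ p (≤-reflexive (sym count≡1)) =
  t , pt , only-t
  where
  rest≡0 : count (p ∖ t) ≡ 0
  rest≡0 = suc-injective (trans (sym (count-remove p pt)) count≡1)
  only-t : ∀ z → p z ≡ true → z ≡ t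
  only-t z pz with z ≟ t
  ... | yes z≡t = z≡t
  ... | no  z≢t with () ← trans (sym (∖-true⁺ p pz z≢t)) (count≡0⇒false (p ∖ t) rest≡0 z)

count≡suc-length⇒unique-other :
  ∀ {n} (p : Fin n → Bool) {xs : List (Fin n)} → Unique xs → All (λ x → p x ≡ true) xs →
  count p ≡ suc (length xs) → ∃ λ t → p t ≡ true × t ∉ xs × ∀ z → p z ≡ true → z ∈ t ∷ xs
count≡suc-length⇒unique-other p [] [] count≡1
  with t , pt , only-t ← count≡1⇒unique p count≡1 = t , pt , (λ ()) , λ z pz → here (only-t z pz)
count≡suc-length⇒unique-other p {x ∷ xs} (x≢xs ∷ xs-unique) (px ∷ pxs) count≡
  with t , p∖x-t , t∉xs , others ← count≡suc-length⇒unique-other (p ∖ x) xs-unique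
         (All.zipWith (λ (py , x≢y) → ∖-true⁺ p py (x≢y ∘ sym)) (pxs , x≢xs))
         (suc-injective (trans (sym (count-remove p px)) count≡))
  = t , pt , t∉x∷xs , covered
  where
  pt : p t ≡ true
  pt = proj₁ (∖-true⁻ p p∖x-t)
  t∉x∷xs : t ∉ x ∷ xs
  t∉x∷xs (here t≡x)   = proj₂ (∖-true⁻ p p∖x-t) t≡x
  t∉x∷xs (there t∈xs) = t∉xs t∈xs
  covered : ∀ z → p z ≡ true → z ∈ t ∷ x ∷ xs
  covered z pz with z ≟ x
  ... | yes z≡x = there (here z≡x)
  ... | no  z≢x with others z (∖-true⁺ p pz z≢x)
  ...   | here z≡t    = here z≡t
  ...   | there z∈xs = there (there z∈xs)

module Adjacency {n} (G : Graph n) where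

  infix 4 _∼_
  _∼_ : Fin n → Fin n → Set
  u ∼ v = adj G u v ≡ true

  ∼-sym : ∀ {u v} → u ∼ v → v ∼ u
  ∼-sym {u} {v} u∼v = trans (adj-sym G v u) u∼v

  ∼⇒≢ : ∀ {u v} → u ∼ v → u ≢ v
  ∼⇒≢ {u} u∼u refl with () ← trans (sym u∼u) (adj-irrefl G u)

  infix 4 N[_]⊆_
  N[_]⊆_ : Fin n → List (Fin n) → Set
  N[ v ]⊆ xs = ∀ w → v ∼ w → w ∈ xs

  degree≡count : ∀ v → degree G v ≡ count (adj G v)
  degree≡count v = countF≡count (adj G v)

  degree≡suc-length⇒unique-other : ∀ {v} {xs : List (Fin n)} → Unique xs → All (v ∼_) xs →
    degree G v ≡ suc (length xs) → ∃ λ t → v ∼ t × t ∉ xs × N[ v ]⊆ t ∷ xs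
  degree≡suc-length⇒unique-other {v} xs-unique v∼xs deg≡ =
    count≡suc-length⇒unique-other (adj G v) xs-unique v∼xs (trans (sym (degree≡count v)) deg≡)

  handshake : ∑[ v < n ] degree G v ≡ 2 * edgeCount G
  handshake = begin
    ∑[ i < n ] degree G i                             ≡⟨ sum-cong-≗ degree≡count ⟩
    ∑[ i < n ] ∑[ j < n ] indicator (adj G i j)       ≡⟨ sum-cong-≗ (λ i → sum-cong-≗ (split i)) ⟩
    ∑[ i < n ] ∑[ j < n ] (L i j + L j i)             ≡⟨ sum-cong-≗ (λ i → ∑-distrib-+ (L i) (λ j → L j i)) ⟩
    ∑[ i < n ] (∑[ j < n ] L i j + ∑[ j < n ] L j i)  ≡⟨ ∑-distrib-+ (λ i → sum (L i)) (λ i → ∑[ j < n ] L j i) ⟩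
    E + ∑[ i < n ] ∑[ j < n ] L j i                   ≡⟨ cong (E +_) (∑-comm (λ i j → L j i)) ⟩
    E + E                                             ≡⟨ cong (E +_) (+-identityʳ E) ⟨
    2 * E                                             ≡⟨ cong (2 *_) edgeCount≡E ⟨
    2 * edgeCount G                                   ∎
    where
    open ≡-Reasoning
    forward : Fin n → Fin n → Bool
    forward i j = ⌊ toℕ i <? toℕ j ⌋ ∧ adj G i j
    L : Fin n → Fin n → ℕ
    L i j = indicator (forward i j)
    E : ℕ
    E = ∑[ i < n ] ∑[ j < n ] L i j
    edgeCount≡E : edgeCount G ≡ E
    edgeCount≡E = trans (sum-tabulate (countF ∘ forward) id) (sum-cong-≗ (countF≡count ∘ forward))
    split : ∀ i j → indicator (adj G i j) ≡ L i j + L j i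
    split i j with toℕ i <? toℕ j | toℕ j <? toℕ i
    ... | yes i<j | yes j<i = contradiction i<j (<⇒≯ j<i)
    ... | yes _   | no _    = sym (+-identityʳ _)
    ... | no _    | yes _   = cong indicator (adj-sym G i j)
    ... | no i≮j  | no j≮i with toℕ-injective (≤-antisym (≮⇒≥ j≮i) (≮⇒≥ i≮j))
    ...   | refl rewrite adj-irrefl G i = refl

next-last : ∀ {m} (j : Fin (suc m)) → m ≡ toℕ j → next j ≡ zero
next-last {m} j m≡j with m ℕ.≟ toℕ j
... | yes _   = refl
... | no  m≢j = contradiction m≡j m≢j

toℕ-next : ∀ {m} (j : Fin (suc m)) → m ≢ toℕ j → toℕ (next j) ≡ suc (toℕ j)
toℕ-next {m} j m≢j with m ℕ.≟ toℕ j
... | yes m≡j = contradiction m≡j m≢j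
... | no  m≢j = cong suc (toℕ-lower₁ j m≢j)

next-injective : ∀ {m} {i j : Fin (suc m)} → next i ≡ next j → i ≡ j
next-injective {m} {i} {j} eq = by-cases (m ℕ.≟ toℕ i) (m ℕ.≟ toℕ j)
  where
  by-cases : Dec (m ≡ toℕ i) → Dec (m ≡ toℕ j) → i ≡ j
  by-cases (yes m≡i) (yes m≡j) = toℕ-injective (trans (sym m≡i) m≡j)
  by-cases (yes m≡i) (no  m≢j) with () ← trans (cong toℕ (trans (sym (next-last i m≡i)) eq)) (toℕ-next j m≢j)
  by-cases (no  m≢i) (yes m≡j) with () ← trans (cong toℕ (trans (sym (next-last j m≡j)) (sym eq))) (toℕ-next i m≢i)
  by-cases (no  m≢i) (no  m≢j) =
    toℕ-injective (suc-injective (trans (sym (toℕ-next i m≢i)) (trans (cong toℕ eq) (toℕ-next j m≢j))))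

next-opposite : ∀ {m} (j : Fin (suc m)) → next (opposite (next j)) ≡ opposite j
next-opposite {m} j with m ℕ.≟ toℕ j
... | yes m≡j = begin
  next (opposite zero) ≡⟨ next-last (opposite zero) (sym (opposite-prop zero)) ⟩
  zero                 ≡⟨ toℕ-injective (sym opposite-j≡0) ⟩
  opposite j           ∎
  where
  open ≡-Reasoning
  opposite-j≡0 : toℕ (opposite j) ≡ 0
  opposite-j≡0 = trans (opposite-prop j) (trans (cong (m ∸_) (sym m≡j)) (n∸n≡0 m))
... | no m≢j = toℕ-injective (begin
  toℕ (next (opposite (suc j′)))  ≡⟨ toℕ-next (opposite (suc j′)) m≢opposite ⟩
  suc (toℕ (opposite (suc j′)))   ≡⟨ cong suc (opposite-prop (suc j′)) ⟩
  suc (m ∸ suc (toℕ j′))          ≡⟨ +-∸-assoc 1 j<m ⟨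
  suc m ∸ suc (toℕ j′)            ≡⟨ cong (λ k → suc m ∸ suc k) (toℕ-lower₁ j m≢j) ⟩
  suc m ∸ suc (toℕ j)             ≡⟨ opposite-prop j ⟨
  toℕ (opposite j)                ∎)
  where
  open ≡-Reasoning
  j′ : Fin m
  j′ = lower₁ j m≢j
  j<m : toℕ j′ < m
  j<m = subst (_< m) (sym (toℕ-lower₁ j m≢j)) (≤∧≢⇒< (ℕ.s≤s⁻¹ (toℕ<n j)) (m≢j ∘ sym))
  m≢opposite : m ≢ toℕ (opposite (suc j′))
  m≢opposite m≡ = <-irrefl (trans (sym (opposite-prop (suc j′))) (sym m≡)) (∸-monoʳ-< {m} {suc (toℕ j′)} {0} z<s j<m)

next^ : ∀ {m} → ℕ → Fin (suc m) → Fin (suc m)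
next^ zero    j = j
next^ (suc t) j = next (next^ t j)

next^-next : ∀ {m} t (j : Fin (suc m)) → next^ t (next j) ≡ next (next^ t j)
next^-next zero    j = refl
next^-next (suc t) j = cong next (next^-next t j)

next^-injective : ∀ {m} t {i j : Fin (suc m)} → next^ t i ≡ next^ t j → i ≡ j
next^-injective zero    eq = eq
next^-injective (suc t) eq = next^-injective t (next-injective eq)

toℕ-next^-zero : ∀ {m} t → t ≤ m → toℕ (next^ {m} t zero) ≡ t
toℕ-next^-zero zero        _   = refl
toℕ-next^-zero {m} (suc t) t<m = trans (toℕ-next (next^ t zero) m≢t) (cong suc ih)
  where
  ih : toℕ (next^ t zero) ≡ t
  ih = toℕ-next^-zero t (<⇒≤ t<m)
  m≢t : m ≢ toℕ (next^ t zero)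
  m≢t m≡ = <⇒≢ t<m (sym (trans m≡ ih))

next^-toℕ : ∀ {m} (k : Fin (suc m)) → next^ (toℕ k) zero ≡ k
next^-toℕ k = toℕ-injective (toℕ-next^-zero (toℕ k) (ℕ.s≤s⁻¹ (toℕ<n k)))

module _ {n} {A : Fin n → Fin n → Bool} {col : Fin n → Fin n → ℕ} {m : ℕ} where

  CycleFrom : Fin n → Fin n → Set
  CycleFrom x y = Σ (HasRainbowCycle A col (suc m)) λ C → proj₁ C zero ≡ x × proj₁ C (next zero) ≡ y

  rotate : ℕ → HasRainbowCycle A col (suc m) → HasRainbowCycle A col (suc m)
  rotate t (v , v-injective , v-adj , v-rainbow) =
    v ∘ next^ t , next^-injective t ∘ v-injective , adj′ , λ {i} {j} → rainbow′ {i} {j}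
    where
    shift : ∀ k → v (next (next^ t k)) ≡ v (next^ t (next k))
    shift k = cong v (sym (next^-next t k))
    adj′ : ∀ k → A (v (next^ t k)) (v (next^ t (next k))) ≡ true
    adj′ k = subst (λ w → A (v (next^ t k)) w ≡ true) (shift k) (v-adj (next^ t k))
    rainbow′ : ∀ {i j} → col (v (next^ t i)) (v (next^ t (next i))) ≡ col (v (next^ t j)) (v (next^ t (next j))) →
               i ≡ j
    rainbow′ {i} {j} eq =
      next^-injective t (v-rainbow (trans (cong (col _) (shift i)) (trans eq (cong (col _) (sym (shift j))))))

  reverse : (∀ i j → A i j ≡ A j i) → (∀ i j → col i j ≡ col j i) →
            HasRainbowCycle A col (suc m) → HasRainbowCycle A col (suc m)
  reverse A-sym col-sym (v , v-injective , v-adj , v-rainbow) =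
    v ∘ opposite , opposite-injective ∘ v-injective , adj′ , λ {i} {j} → rainbow′ {i} {j}
    where
    opposite-injective : ∀ {i j : Fin (suc m)} → opposite i ≡ opposite j → i ≡ j
    opposite-injective {i} {j} eq = trans (sym (opposite-involutive i)) (trans (cong opposite eq) (opposite-involutive j))
    back : ∀ k → v (next (opposite (next k))) ≡ v (opposite k)
    back k = cong v (next-opposite k)
    adj′ : ∀ k → A (v (opposite k)) (v (opposite (next k))) ≡ true
    adj′ k = trans (A-sym _ _) (subst (λ w → A (v (opposite (next k))) w ≡ true) (back k) (v-adj (opposite (next k))))
    colour : ∀ k → col (v (opposite k)) (v (opposite (next k))) ≡ col (v (opposite (next k))) (v (next (opposite (next k))))
    colour k = trans (col-sym _ _) (cong (col _) (sym (back k)))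
    rainbow′ : ∀ {i j} → col (v (opposite i)) (v (opposite (next i))) ≡ col (v (opposite j)) (v (opposite (next j))) →
               i ≡ j
    rainbow′ {i} {j} eq = next-injective (opposite-injective (v-rainbow (trans (sym (colour i)) (trans eq (colour j)))))

  start-at : ∀ {x y} (C : HasRainbowCycle A col (suc m)) k →
             proj₁ C k ≡ x → proj₁ C (next k) ≡ y → CycleFrom x y
  start-at C@(v , _) k vk≡x vk′≡y =
    rotate (toℕ k) C ,
    trans (cong v (next^-toℕ k)) vk≡x ,
    trans (cong v (trans (next^-next (toℕ k) zero) (cong next (next^-toℕ k)))) vk′≡y

  start-at-edge : (∀ i j → A i j ≡ A j i) → (∀ i j → col i j ≡ col j i) →
    ∀ {x y} (C : HasRainbowCycle A col (suc m)) k →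
    (proj₁ C k ≡ x × proj₁ C (next k) ≡ y) ⊎ (proj₁ C k ≡ y × proj₁ C (next k) ≡ x) →
    CycleFrom x y
  start-at-edge _     _       C k (inj₁ (vk≡x , vk′≡y)) = start-at C k vk≡x vk′≡y
  start-at-edge A-sym col-sym C@(v , _) k (inj₂ (vk≡y , vk′≡x)) =
    start-at (reverse A-sym col-sym C) (opposite (next k))
      (trans (cong v (opposite-involutive (next k))) vk′≡x)
      (trans (cong (v ∘ opposite) (next-opposite k)) (trans (cong v (opposite-involutive k)) vk≡y))

module _ {n} (x y : Fin n) where

  isPair-true : ∀ {i j} → isPair x y i j ≡ true → (i ≡ x × j ≡ y) ⊎ (i ≡ y × j ≡ x)
  isPair-true {i} {j} eq with i ≟ x | j ≟ y | i ≟ y | j ≟ x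
  ... | yes i≡x | yes j≡y | _       | _       = inj₁ (i≡x , j≡y)
  ... | _       | _       | yes i≡y | yes j≡x = inj₂ (i≡y , j≡x)

  isPair-refl : isPair x y x y ≡ true
  isPair-refl with x ≟ x | y ≟ y
  ... | yes _   | yes _   = refl
  ... | no  x≢x | _       = contradiction refl x≢x
  ... | yes _   | no  y≢y = contradiction refl y≢y

  isPair-sym : ∀ i j → isPair x y i j ≡ isPair x y j i
  isPair-sym i j = trans (∨-comm (⌊ i ≟ x ⌋ ∧ ⌊ j ≟ y ⌋) _) (cong₂ _∨_ (∧-comm ⌊ i ≟ y ⌋ _) (∧-comm ⌊ i ≟ x ⌋ _))

  isPair-∉ˡ : ∀ {i} j → i ∉ x ∷ y ∷ [] → isPair x y i j ≡ false
  isPair-∉ˡ j i∉ = ¬-not λ eq → case isPair-true eq of λ where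
    (inj₁ (i≡x , _)) → i∉ (here i≡x)
    (inj₂ (i≡y , _)) → i∉ (there (here i≡y))

  isPair-∉ʳ : ∀ i {j} → j ∉ x ∷ y ∷ [] → isPair x y i j ≡ false
  isPair-∉ʳ i {j} j∉ = trans (isPair-sym i j) (isPair-∉ˡ i j∉)

  addAdj-unchanged : ∀ (G : Graph n) i j → isPair x y i j ≡ false → addAdj G x y i j ≡ adj G i j
  addAdj-unchanged G i j not-xy = trans (cong (adj G i j ∨_) not-xy) (∨-identityʳ _)

  addCol-unchanged : ∀ (c : Fin n → Fin n → ℕ) a i j → isPair x y i j ≡ false → addCol c x y a i j ≡ c i j
  addCol-unchanged c a i j not-xy = cong (λ b → if b then a else c i j) not-xy

module Saturated {n m} (G : Graph n) (c : Fin n → Fin n → ℕ) (c-sym : ∀ i j → c i j ≡ c j i)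
                 (saturated : RainbowSaturated G (c , c-sym) (5 + m)) (3<n : 3 < n) where

  open Adjacency G

  new-edge-starts-cycle : ∀ {x y} → x ≢ y → adj G x y ≡ false → ∀ a →
    CycleFrom {A = addAdj G x y} {addCol c x y a} {4 + m} x y
  new-edge-starts-cycle {x} {y} x≢y x≁y a
    with C@(v , v-injective , v-adj , v-rainbow) ← proj₂ saturated x y x≢y x≁y a
       | any? (λ k → isPair x y (v k) (v (next k)) Bool.≟ true)
  ... | yes (k , xy-at-k) = start-at-edge addAdj-sym addCol-sym C k (isPair-true x y xy-at-k)
    where
    addAdj-sym : ∀ i j → addAdj G x y i j ≡ addAdj G x y j i
    addAdj-sym i j = cong₂ _∨_ (adj-sym G i j) (isPair-sym x y i j)
    addCol-sym : ∀ i j → addCol c x y a i j ≡ addCol c x y a j i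
    addCol-sym i j rewrite isPair-sym x y i j | c-sym i j = refl
  ... | no xy-unused =
    contradiction (v , (λ {i j} → v-injective {i} {j}) , adj′ , λ {i} {j} → rainbow′ {i} {j}) (proj₁ saturated)
    where
    not-xy : ∀ k → isPair x y (v k) (v (next k)) ≡ false
    not-xy k = ¬-not (xy-unused ∘ (k ,_))
    adj′ : ∀ k → v k ∼ v (next k)
    adj′ k = trans (sym (addAdj-unchanged x y G _ _ (not-xy k))) (v-adj k)
    colour : ∀ k → addCol c x y a (v k) (v (next k)) ≡ c (v k) (v (next k))
    colour k = addCol-unchanged x y c a _ _ (not-xy k)
    rainbow′ : ∀ {i j} → c (v i) (v (next i)) ≡ c (v j) (v (next j)) → i ≡ j
    rainbow′ {i} {j} eq = v-rainbow (trans (colour i) (trans eq (sym (colour j))))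

  record Detour (x y : Fin n) (a : ℕ) : Set where
    field
      z₁ z₂ z₃ : Fin n
      y∼z₁     : y ∼ z₁
      z₁∼z₂    : z₁ ∼ z₂
      z₂∼z₃    : z₂ ∼ z₃
      colour≢  : c y z₁ ≢ a
      z₁∉      : z₁ ∉ x ∷ y ∷ []
      z₂∉      : z₂ ∉ x ∷ y ∷ z₁ ∷ []
      z₃∉      : z₃ ∉ x ∷ y ∷ z₁ ∷ []

  detour : ∀ {x y} → x ≢ y → adj G x y ≡ false → ∀ a → Detour x y a
  detour x≢y x≁y a with (v , v-injective , v-adj , v-rainbow) , refl , refl ← new-edge-starts-cycle x≢y x≁y a =
    record
      { z₁ = v 2F ; z₂ = v 3F ; z₃ = v 4F
      ; y∼z₁    = edge-of-G 1F (isPair-∉ʳ x y (v 1F) z₁∉)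
      ; z₁∼z₂   = edge-of-G 2F (isPair-∉ˡ x y (v 3F) z₁∉)
      ; z₂∼z₃   = edge-of-G 3F (isPair-∉ˡ x y (v 4F) (z₂∉ ∘ ∈-++⁺ˡ))
      ; colour≢ = λ c≡a → case v-rainbow {0F} {1F} (trans colour-0 (trans (sym c≡a) (sym colour-1))) of λ ()
      ; z₁∉ = z₁∉ ; z₂∉ = z₂∉ ; z₃∉ = v-∉ ((λ ()) ∷ (λ ()) ∷ (λ ()) ∷ [])
      }
    where
    v-∉ : ∀ {i js} → All (i ≢_) js → v i ∉ map v js
    v-∉ (i≢j ∷ _)   (here vi≡vj)  = i≢j (v-injective vi≡vj)
    v-∉ (_ ∷ i≢js)  (there vi∈vjs) = v-∉ i≢js vi∈vjs
    z₁∉ : v 2F ∉ v 0F ∷ v 1F ∷ []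
    z₁∉ = v-∉ ((λ ()) ∷ (λ ()) ∷ [])
    z₂∉ : v 3F ∉ v 0F ∷ v 1F ∷ v 2F ∷ []
    z₂∉ = v-∉ ((λ ()) ∷ (λ ()) ∷ (λ ()) ∷ [])
    x y : Fin n
    x = v 0F
    y = v 1F
    edge-of-G : ∀ k → isPair x y (v k) (v (next k)) ≡ false → v k ∼ v (next k)
    edge-of-G k not-new = trans (sym (addAdj-unchanged x y G _ _ not-new)) (v-adj k)
    colour-0 : addCol c x y a x y ≡ a
    colour-0 = cong (λ b → if b then a else c x y) (isPair-refl x y)
    colour-1 : addCol c x y a y (v 2F) ≡ c y (v 2F)
    colour-1 = addCol-unchanged x y c a y (v 2F) (isPair-∉ʳ x y y z₁∉)

  outside : ∀ xs → length xs ≤ 3 → ∃ (_∉ xs)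
  outside xs |xs|≤3 = ∃∉ xs (≤-<-trans |xs|≤3 3<n)

  non-neighbour : ∀ {x y xs} → N[ y ]⊆ xs → x ∉ xs → adj G x y ≡ false
  non-neighbour {x} {y} N-y x∉xs = ¬-not λ x∼y → x∉xs (N-y x (∼-sym x∼y))

  degree≢0 : ∀ y → degree G y ≢ 0
  degree≢0 y deg≡0 with x , x∉ ← outside (y ∷ []) (s≤s z≤n) =
    let open Detour (detour (x∉ ∘ here) (non-neighbour N-y λ ()) 0) in
    case N-y z₁ y∼z₁ of λ ()
    where
    N-y : N[ y ]⊆ []
    N-y w y∼w with () ← trans (sym y∼w) (count≡0⇒false (adj G y) (trans (sym (degree≡count y)) deg≡0) w)

  degree≢1 : ∀ y → degree G y ≢ 1
  degree≢1 y deg≡1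
    with z , _ , _ , N-y ← degree≡suc-length⇒unique-other [] [] deg≡1
    with x , x∉ ← outside (y ∷ z ∷ []) (s≤s (s≤s z≤n)) =
    let open Detour (detour (x∉ ∘ here) (non-neighbour N-y (x∉ ∘ there)) (c y z)) in
    case N-y z₁ y∼z₁ of λ where
      (here z₁≡z) → colour≢ (cong (c y) z₁≡z)

  degree≥2 : ∀ y → 2 ≤ degree G y
  degree≥2 y with degree G y in deg-y
  ... | 0           = contradiction deg-y (degree≢0 y)
  ... | 1           = contradiction deg-y (degree≢1 y)
  ... | suc (suc _) = s≤s (s≤s z≤n)

  triangle-closes : ∀ {y a b z} → N[ y ]⊆ b ∷ a ∷ [] → N[ a ]⊆ z ∷ y ∷ [] → a ∼ z → z ≢ y → z ≡ b
  triangle-closes {y} {a} {b} {z} N-y N-a a∼z z≢y with z ≟ b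
  ... | yes z≡b = z≡b
  ... | no  z≢b = ⊥-elim (
    let open Detour (detour z≢y (non-neighbour N-y z∉) (c y b)) in
    case N-y z₁ y∼z₁ of λ where
      (here z₁≡b)         → contradiction (cong (c y) z₁≡b) colour≢
      (there (here z₁≡a)) → z₂∉ (∈-++⁺ˡ (N-a z₂ (subst (_∼ z₂) z₁≡a z₁∼z₂))))
    where
    z∉ : z ∉ b ∷ a ∷ []
    z∉ (here z≡b)         = z≢b z≡b
    z∉ (there (here z≡a)) = ∼⇒≢ a∼z (sym z≡a)

  record PendantTriangle (v u b : Fin n) : Set where
    field
      v∼u : v ∼ u
      b∼v : b ∼ v
      b∼u : b ∼ u
      N-v : N[ v ]⊆ b ∷ u ∷ []
      N-u : N[ u ]⊆ b ∷ v ∷ []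

  pendant-triangle-one-exit : ∀ {v u b t} → PendantTriangle v u b →
                              N[ b ]⊆ t ∷ v ∷ u ∷ [] → t ∉ v ∷ u ∷ b ∷ [] → ⊥
  pendant-triangle-one-exit {v} {u} {b} {t} T N-b t∉ =
    let open Detour (detour (t∉ ∘ here) (non-neighbour N-v t∉′) 0) in
    case N-v z₁ y∼z₁ of λ where
      (here z₁≡b) → case N-b z₂ (subst (_∼ z₂) z₁≡b z₁∼z₂) of λ where
        (here z₂≡t)                 → z₂∉ (here z₂≡t)
        (there (here z₂≡v))         → z₂∉ (there (here z₂≡v))
        (there (there (here z₂≡u))) → case N-u z₃ (subst (_∼ z₃) z₂≡u z₂∼z₃) of λ where
          (here z₃≡b)         → z₃∉ (there (there (here (trans z₃≡b (sym z₁≡b)))))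
          (there (here z₃≡v)) → z₃∉ (there (here z₃≡v))
      (there (here z₁≡u)) → case N-u z₂ (subst (_∼ z₂) z₁≡u z₁∼z₂) of λ where
        (here z₂≡b)         → case N-b z₃ (subst (_∼ z₃) z₂≡b z₂∼z₃) of λ where
          (here z₃≡t)                 → z₃∉ (here z₃≡t)
          (there (here z₃≡v))         → z₃∉ (there (here z₃≡v))
          (there (there (here z₃≡u))) → z₃∉ (there (there (here (trans z₃≡u (sym z₁≡u)))))
        (there (here z₂≡v)) → z₂∉ (there (here z₂≡v))
    where
    open PendantTriangle T
    t∉′ : t ∉ b ∷ u ∷ []
    t∉′ (here t≡b)         = t∉ (there (there (here t≡b)))
    t∉′ (there (here t≡u)) = t∉ (there (here t≡u))

  degree-2-pair⇒pendant-triangle : ∀ {v u} → degree G v ≡ 2 → v ∼ u → degree G u ≡ 2 →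
                                   ∃ (PendantTriangle v u)
  degree-2-pair⇒pendant-triangle {v} {u} deg-v v∼u deg-u
    with b , v∼b , _ , N-v ← degree≡suc-length⇒unique-other ([] ∷ []) (v∼u ∷ []) deg-v
    with z , u∼z , z∉ , N-u ← degree≡suc-length⇒unique-other ([] ∷ []) (∼-sym v∼u ∷ []) deg-u
    with refl ← triangle-closes N-v N-u u∼z (z∉ ∘ here)
    = b , record { v∼u = v∼u ; b∼v = ∼-sym v∼b ; b∼u = ∼-sym u∼z ; N-v = N-v ; N-u = N-u }

  pendant-apex-degree≢2 : ∀ {v u b} → PendantTriangle v u b → degree G b ≢ 2
  pendant-apex-degree≢2 {v} {u} {b} T@record { v∼u = v∼u ; b∼v = b∼v ; b∼u = b∼u } deg-b
    with z , _ , _ , N-b ← degree≡suc-length⇒unique-other ([] ∷ []) (b∼v ∷ []) deg-b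
    with t , t∉ ← outside (v ∷ u ∷ b ∷ []) ≤-refl
    with N-b u b∼u
  ... | there (here u≡v) = ∼⇒≢ v∼u (sym u≡v)
  ... | here u≡z = pendant-triangle-one-exit T N-b′ t∉
    where
    N-b′ : N[ b ]⊆ t ∷ v ∷ u ∷ []
    N-b′ w b∼w with N-b w b∼w
    ... | here w≡z         = there (there (here (trans w≡z (sym u≡z))))
    ... | there (here w≡v) = there (here w≡v)

  pendant-apex-degree≢3 : ∀ {v u b} → PendantTriangle v u b → degree G b ≢ 3
  pendant-apex-degree≢3 {v} {u} {b} T@record { v∼u = v∼u ; b∼v = b∼v ; b∼u = b∼u } deg-b
    with t , b∼t , t∉vu , N-b ← degree≡suc-length⇒unique-other ((∼⇒≢ v∼u ∷ []) ∷ [] ∷ []) (b∼v ∷ b∼u ∷ []) deg-b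
    = pendant-triangle-one-exit T N-b λ where
        (here t≡v)                 → t∉vu (here t≡v)
        (there (here t≡u))         → t∉vu (there (here t≡u))
        (there (there (here t≡b))) → ∼⇒≢ b∼t (sym t≡b)

  HasDeg2Neighbour : Fin n → Set
  HasDeg2Neighbour v = ∃ λ u → v ∼ u × degree G u ≡ 2

  hasDeg2Neighbour? : ∀ v → Dec (HasDeg2Neighbour v)
  hasDeg2Neighbour? v = any? λ u → (adj G v u Bool.≟ true) ×-dec (degree G u ℕ.≟ 2)

  transfer : Fin n → Fin n → ℕ
  transfer w v with adj G w v | degree G v ℕ.≟ 2 | degree G w ℕ.≟ 2 | hasDeg2Neighbour? v
  ... | true | yes _ | no _ | yes _ = 2
  ... | true | yes _ | no _ | no _  = 1
  ... | _    | _     | _    | _     = 0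

  transfer≤2·adj : ∀ w v → transfer w v ≤ 2 * indicator (adj G w v)
  transfer≤2·adj w v with adj G w v | degree G v ℕ.≟ 2 | degree G w ℕ.≟ 2 | hasDeg2Neighbour? v
  ... | true  | yes _ | no _  | yes _ = ≤-refl
  ... | true  | yes _ | no _  | no _  = s≤s z≤n
  ... | true  | yes _ | yes _ | _     = z≤n
  ... | true  | no _  | _     | _     = z≤n
  ... | false | _     | _     | _     = z≤n

  transfer-from-degree-2 : ∀ {w} → degree G w ≡ 2 → ∀ v → transfer w v ≡ 0
  transfer-from-degree-2 {w} deg-w v with adj G w v | degree G v ℕ.≟ 2 | degree G w ℕ.≟ 2 | hasDeg2Neighbour? v
  ... | true  | yes _ | no ¬deg-w | _ = contradiction deg-w ¬deg-w
  ... | true  | yes _ | yes _     | _ = refl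
  ... | true  | no _  | _         | _ = refl
  ... | false | _     | _         | _ = refl

  degree-3-neighbour⇒no-deg2-neighbour : ∀ {w v} → degree G w ≡ 3 → w ∼ v → degree G v ≡ 2 →
                                         ¬ HasDeg2Neighbour v
  degree-3-neighbour⇒no-deg2-neighbour {w} deg-w w∼v deg-v (u , v∼u , deg-u)
    with b , T ← degree-2-pair⇒pendant-triangle deg-v v∼u deg-u
    with PendantTriangle.N-v T w (∼-sym w∼v)
  ... | here refl         = pendant-apex-degree≢3 T deg-w
  ... | there (here refl) = case trans (sym deg-w) deg-u of λ ()

  transfer-from-degree-3 : ∀ {w} → degree G w ≡ 3 → ∀ v → transfer w v ≤ indicator (adj G w v)
  transfer-from-degree-3 {w} deg-w v with adj G w v in w∼v | degree G v ℕ.≟ 2 | degree G w ℕ.≟ 2 | hasDeg2Neighbour? v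
  ... | true  | yes deg-v | no _  | yes has = contradiction has (degree-3-neighbour⇒no-deg2-neighbour deg-w w∼v deg-v)
  ... | true  | yes _     | no _  | no _    = ≤-refl
  ... | true  | yes _     | yes _ | _       = z≤n
  ... | true  | no _      | _     | _       = z≤n
  ... | false | _         | _     | _       = z≤n

  inflow outflow : Fin n → ℕ
  inflow  v = ∑[ w < n ] transfer w v
  outflow v = ∑[ w < n ] transfer v w

  inflow-degree-2 : ∀ {v} → degree G v ≡ 2 → 2 ≤ inflow v
  inflow-degree-2 {v} deg-v = by-cases (hasDeg2Neighbour? v)
    where
    from-apex : ∀ {u b} → HasDeg2Neighbour v → PendantTriangle v u b → transfer b v ≡ 2
    from-apex {b = b} has T with adj G b v in b∼v | degree G v ℕ.≟ 2 | degree G b ℕ.≟ 2 | hasDeg2Neighbour? v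
    ... | true  | yes _  | no _      | yes _    = refl
    ... | true  | yes _  | no _      | no ¬has  = contradiction has ¬has
    ... | true  | yes _  | yes deg-b | _        = contradiction deg-b (pendant-apex-degree≢2 T)
    ... | true  | no ¬deg-v | _      | _        = contradiction deg-v ¬deg-v
    ... | false | _      | _         | _        = case trans (sym b∼v) (PendantTriangle.b∼v T) of λ ()

    from-neighbour : ¬ HasDeg2Neighbour v → ∀ w → transfer w v ≡ indicator (adj G v w)
    from-neighbour ¬has w rewrite adj-sym G v w
      with adj G w v in w∼v | degree G v ℕ.≟ 2 | degree G w ℕ.≟ 2 | hasDeg2Neighbour? v
    ... | true  | yes _     | no _      | yes has = contradiction has ¬has
    ... | true  | yes _     | no _      | no _    = refl
    ... | true  | yes _     | yes deg-w | _       = contradiction (w , ∼-sym w∼v , deg-w) ¬has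
    ... | true  | no ¬deg-v | _         | _       = contradiction deg-v ¬deg-v
    ... | false | _         | _         | _       = refl

    by-cases : Dec (HasDeg2Neighbour v) → 2 ≤ inflow v
    by-cases (yes has@(u , v∼u , deg-u)) with b , T ← degree-2-pair⇒pendant-triangle deg-v v∼u deg-u =
      ≤-trans (≤-reflexive (sym (from-apex has T))) (term≤sum (λ w → transfer w v) b)
    by-cases (no ¬has) = ≤-reflexive (sym (begin
      inflow v                  ≡⟨ sum-cong-≗ (from-neighbour ¬has) ⟩
      count (adj G v)           ≡⟨ degree≡count v ⟨
      degree G v                ≡⟨ deg-v ⟩
      2                         ∎))
      where open ≡-Reasoning

  charge-balance : ∀ v → 12 + outflow v ≤ 5 * degree G v + inflow v
  charge-balance v = by-degree (degree G v) refl (degree≥2 v)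
    where
    open ≤-Reasoning
    by-degree : ∀ d → degree G v ≡ d → 2 ≤ d → 12 + outflow v ≤ 5 * d + inflow v
    by-degree 2 deg-v _ = begin
      12 + outflow v  ≡⟨ cong (12 +_) (trans (sum-cong-≗ (transfer-from-degree-2 deg-v)) (trans (sum-const n 0) (*-zeroʳ n))) ⟩
      12 + 0          ≤⟨ +-monoʳ-≤ 10 (inflow-degree-2 deg-v) ⟩
      10 + inflow v   ∎
    by-degree 3 deg-v _ = begin
      12 + outflow v  ≤⟨ +-monoʳ-≤ 12 (sum-mono-≤ (transfer-from-degree-3 deg-v)) ⟩
      12 + count (adj G v) ≡⟨ cong (12 +_) (trans (sym (degree≡count v)) deg-v) ⟩
      15              ≤⟨ m≤m+n 15 (inflow v) ⟩
      15 + inflow v   ∎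
    by-degree 1 _ (s≤s ())
    by-degree d@(suc (suc (suc (suc _)))) deg-v _ = begin
      12 + outflow v                   ≤⟨ +-monoʳ-≤ 12 (sum-mono-≤ (transfer≤2·adj v)) ⟩
      12 + ∑[ w < n ] (2 * indicator (adj G v w)) ≡⟨ cong (12 +_) (sym (*-distribˡ-sum 2 (indicator ∘ adj G v))) ⟩
      12 + 2 * count (adj G v)         ≡⟨ cong (λ k → 12 + 2 * k) (trans (sym (degree≡count v)) deg-v) ⟩
      12 + 2 * d                       ≤⟨ +-monoˡ-≤ (2 * d) (*-monoʳ-≤ 3 (s≤s (s≤s (s≤s (s≤s z≤n))))) ⟩
      3 * d + 2 * d                    ≡⟨ *-distribʳ-+ d 3 2 ⟨
      5 * d                            ≤⟨ m≤m+n (5 * d) (inflow v) ⟩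
      5 * d + inflow v                 ∎

  total-charge : n * 12 ≤ 5 * (2 * edgeCount G)
  total-charge = +-cancelʳ-≤ (sum outflow) _ _ (begin
    n * 12 + sum outflow                        ≡⟨ cong (_+ sum outflow) (sum-const n 12) ⟨
    ∑[ v < n ] 12 + sum outflow                 ≡⟨ ∑-distrib-+ (λ _ → 12) outflow ⟨
    ∑[ v < n ] (12 + outflow v)                 ≤⟨ sum-mono-≤ charge-balance ⟩
    ∑[ v < n ] (5 * degree G v + inflow v)      ≡⟨ ∑-distrib-+ (λ v → 5 * degree G v) inflow ⟩
    ∑[ v < n ] (5 * degree G v) + sum inflow    ≡⟨ cong₂ _+_ (*-distribˡ-sum 5 (degree G)) (∑-comm transfer) ⟨
    5 * ∑[ v < n ] degree G v + sum outflow     ≡⟨ cong (λ k → 5 * k + sum outflow) handshake ⟩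
    5 * (2 * edgeCount G) + sum outflow         ∎)
    where open ≤-Reasoning

  six-fifths : 6 * n ≤ 5 * edgeCount G
  six-fifths = *-cancelˡ-≤ 2 (begin
    2 * (6 * n)            ≡⟨ *-assoc 2 6 n ⟨
    12 * n                 ≡⟨ *-comm 12 n ⟩
    n * 12                 ≤⟨ total-charge ⟩
    5 * (2 * edgeCount G)  ≡⟨ *-assoc 5 2 (edgeCount G) ⟨
    10 * edgeCount G       ≡⟨ *-assoc 2 5 (edgeCount G) ⟩
    2 * (5 * edgeCount G)  ∎)
    where open ≤-Reasoning

proposition7p4 : (n r : ℕ) → 5 ≤ r → r ≤ n → (G : Graph n) → (c : SymColoring n)
    → RainbowSaturated G c r → Σ (Fin n) (GoodRoot G)
    → 6 * n ≤ 5 * edgeCount G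
proposition7p4 n (suc (suc (suc (suc (suc m))))) (s≤s (s≤s (s≤s (s≤s (s≤s z≤n))))) 5+m≤n G (c , c-sym) saturated _ =
  Saturated.six-fifths G c c-sym saturated (≤-trans (s≤s (s≤s (s≤s (s≤s z≤n)))) 5+m≤n)
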